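{- Let $\Sigma$ be a HIT-signature, let $X,Y$ be algebras for $\Sigma$ in 1-types and let $f:X\to Y$ be an algebra morphism. If the underlying function of $f$ is an adjoint equivalence in $1\text{ - }\mathrm{Type}$ (i.e. an equivalence of types), then $f$ is an adjoint equivalence in the bicategory $\mathrm{Alg}(\Sigma)$.
   Context: Work in homotopy type theory with univalence. A HIT-signature $\Sigma$ consists of a polynomial code $P$ (codes generated by constants $C_Z$, $\mathsf{Id}$, $+$, $\times$), path constructors given by pairs of path endpoints $l_j,r_j$ from codes $Q_j$ to $\mathsf{Id}$, and homotopy constructors given by pairs of homotopy endpoints, all interpreted by structural recursion. $\mathrm{Alg}(\Sigma)$: objects are 1-types $X$ with $c_X:P(X)\to X$, paths $p^X_j(x):[\![l_j]\!](x)=[\![r_j]\!](x)$, and the homotopy equations; 1-cells $f:X\to Y$ are maps with paths $f_c(x):f(c_X(x))=c_Y(P(f)(x))$ and, for each $j,x$, an equality $\mathsf{ap}_f(p^X_j(x))\bullet[\![r_j]\!](f)(x)=[\![l_j]\!](f)(x)\bullet p^Y_j(Q_j(f)(x))$ with $[\![e]\!](f)(x)$ built from $f_c$; 2-cells $f\Rightarrow g$ are homotopies $\theta$ with $\theta(c_X(x))\bullet g_c(x)=f_c(x)\bullet\mathsf{ap}_{c_Y}(P(\theta)(x))$. An adjoint equivalence in a bicategory is a 1-cell $f$ with a 1-cell $g$ in the opposite direction and invertible 2-cells $\mathrm{id}\Rightarrow f\cdot g$, $g\cdot f\Rightarrow\mathrm{id}$ satisfying the triangle identities. -}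

{-# OPTIONS --without-K #-}
module Defs where

open import Data.Sum using (_⊎_; inj₁; inj₂)
open import Data.Product using (Σ; _,_; proj₁; proj₂; _×_)
open import Function using (_∘_; id)
open import Relation.Binary.PropositionalEquality
  using (_≡_; refl; sym; trans; cong; cong₂; module ≡-Reasoning)
open import Relation.Binary.PropositionalEquality.Properties
  using (trans-reflʳ; trans-assoc; cong-id; cong-∘; trans-cong)

isProp : Set → Set
isProp A = (x y : A) → x ≡ y

isSet : Set → Set
isSet A = (x y : A) → isProp (x ≡ y)

is1Type : Set → Set
is1Type A = (x y : A) → isSet (x ≡ y)

module _ {A B : Set} where
  nat : {u v : A → B} (H : ∀ a → u a ≡ v a) {a b : A} (q : a ≡ b) →
        trans (H a) (cong v q) ≡ trans (cong u q) (H b)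
  nat H {a} refl = trans-reflʳ (H a)

  cong-const : {b : B} {a a' : A} (p : a ≡ a') → cong (λ _ → b) p ≡ refl
  cong-const refl = refl

module _ {A B : Set} where
  trans-, : {a a' a'' : A} {b b' b'' : B}
            (p : a ≡ a') (q : b ≡ b') (p' : a' ≡ a'') (q' : b' ≡ b'') →
            trans (cong₂ _,_ p q) (cong₂ _,_ p' q') ≡ cong₂ _,_ (trans p p') (trans q q')
  trans-, refl refl p' q' = refl

module _ {A B C : Set} where
  cong-, : {u : C → A} {v : C → B} {c c' : C} (r : c ≡ c') →
           cong (λ y → (u y , v y)) r ≡ cong₂ _,_ (cong u r) (cong v r)
  cong-, refl = refl

module _ {A B : Set} where
  cong-proj₁ : {a a' : A} {b b' : B} (p : a ≡ a') (q : b ≡ b') →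
               cong proj₁ (cong₂ _,_ p q) ≡ p
  cong-proj₁ refl refl = refl

  cong-proj₂ : {a a' : A} {b b' : B} (p : a ≡ a') (q : b ≡ b') →
               cong proj₂ (cong₂ _,_ p q) ≡ q
  cong-proj₂ refl refl = refl

module _ {A B A' B' : Set} where
  cong-map-, : {f : A → A'} {g : B → B'} {a a' : A} {b b' : B}
               (p : a ≡ a') (q : b ≡ b') →
               cong (λ z → (f (proj₁ z) , g (proj₂ z))) (cong₂ _,_ p q)
               ≡ cong₂ _,_ (cong f p) (cong g q)
  cong-map-, refl refl = refl

-- Polynomial codes and their interpretation (structural recursion)

infixr 5 _⊕_
infixr 6 _⊗_

data Code : Set₁ where
  C   : (Z : Set) → is1Type Z → Code
  I   : Code
  _⊕_ : Code → Code → Code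
  _⊗_ : Code → Code → Code

⟦_⟧ : Code → Set → Set
⟦ C Z _ ⟧ X = Z
⟦ I ⟧ X = X
⟦ P ⊕ Q ⟧ X = ⟦ P ⟧ X ⊎ ⟦ Q ⟧ X
⟦ P ⊗ Q ⟧ X = ⟦ P ⟧ X × ⟦ Q ⟧ X

fmap : (P : Code) {X Y : Set} → (X → Y) → ⟦ P ⟧ X → ⟦ P ⟧ Y
fmap (C Z _) f z = z
fmap I f x = f x
fmap (P ⊕ Q) f (inj₁ x) = inj₁ (fmap P f x)
fmap (P ⊕ Q) f (inj₂ y) = inj₂ (fmap Q f y)
fmap (P ⊗ Q) f (x , y) = fmap P f x , fmap Q f y

fmap₂ : (P : Code) {X Y : Set} {f g : X → Y} → (∀ x → f x ≡ g x) →
        ∀ x → fmap P f x ≡ fmap P g x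
fmap₂ (C Z _) θ z = refl
fmap₂ I θ x = θ x
fmap₂ (P ⊕ Q) θ (inj₁ x) = cong inj₁ (fmap₂ P θ x)
fmap₂ (P ⊕ Q) θ (inj₂ y) = cong inj₂ (fmap₂ Q θ y)
fmap₂ (P ⊗ Q) θ (x , y) = cong₂ _,_ (fmap₂ P θ x) (fmap₂ Q θ y)

fmap-id : (P : Code) {X : Set} (x : ⟦ P ⟧ X) → fmap P id x ≡ x
fmap-id (C Z _) z = refl
fmap-id I x = refl
fmap-id (P ⊕ Q) (inj₁ x) = cong inj₁ (fmap-id P x)
fmap-id (P ⊕ Q) (inj₂ y) = cong inj₂ (fmap-id Q y)
fmap-id (P ⊗ Q) (x , y) = cong₂ _,_ (fmap-id P x) (fmap-id Q y)

fmap-∘ : (P : Code) {X Y Z : Set} (f : X → Y) (g : Y → Z) (x : ⟦ P ⟧ X) →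
         fmap P g (fmap P f x) ≡ fmap P (g ∘ f) x
fmap-∘ (C Z _) f g z = refl
fmap-∘ I f g x = refl
fmap-∘ (P ⊕ Q) f g (inj₁ x) = cong inj₁ (fmap-∘ P f g x)
fmap-∘ (P ⊕ Q) f g (inj₂ y) = cong inj₂ (fmap-∘ Q f g y)
fmap-∘ (P ⊗ Q) f g (x , y) = cong₂ _,_ (fmap-∘ P f g x) (fmap-∘ Q f g y)

fmap-inj₁ : (P Q : Code) {X Y : Set} (h : X → Y) {a b : ⟦ P ⟧ X} (p : a ≡ b) →
  cong (fmap (P ⊕ Q) h) (cong inj₁ p) ≡ cong inj₁ (cong (fmap P h) p)
fmap-inj₁ P Q h refl = refl

fmap-inj₂ : (P Q : Code) {X Y : Set} (h : X → Y) {a b : ⟦ Q ⟧ X} (p : a ≡ b) →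
  cong (fmap (P ⊕ Q) h) (cong inj₂ p) ≡ cong inj₂ (cong (fmap Q h) p)
fmap-inj₂ P Q h refl = refl

fmap-pair : (P Q : Code) {X Y : Set} (h : X → Y) {a b : ⟦ P ⟧ X} {c d : ⟦ Q ⟧ X}
  (p : a ≡ b) (q : c ≡ d) →
  cong (fmap (P ⊗ Q) h) (cong₂ _,_ p q) ≡ cong₂ _,_ (cong (fmap P h) p) (cong (fmap Q h) q)
fmap-pair P Q h refl refl = refl

fmap₂-refl : (P : Code) {X Y : Set} {f : X → Y} (x : ⟦ P ⟧ X) →
  fmap₂ P {f = f} {g = f} (λ _ → refl) x ≡ refl
fmap₂-refl (C Z _) z = refl
fmap₂-refl I x = refl
fmap₂-refl (P ⊕ Q) (inj₁ x) = cong (cong inj₁) (fmap₂-refl P x)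
fmap₂-refl (P ⊕ Q) (inj₂ y) = cong (cong inj₂) (fmap₂-refl Q y)
fmap₂-refl (P ⊗ Q) (x , y) = cong₂ (cong₂ _,_) (fmap₂-refl P x) (fmap₂-refl Q y)

fmap₂-trans : (P : Code) {X Y : Set} {f g h : X → Y}
  (θ : ∀ x → f x ≡ g x) (ζ : ∀ x → g x ≡ h x) (x : ⟦ P ⟧ X) →
  fmap₂ P (λ y → trans (θ y) (ζ y)) x ≡ trans (fmap₂ P θ x) (fmap₂ P ζ x)
fmap₂-trans (C Z _) θ ζ z = refl
fmap₂-trans I θ ζ x = refl
fmap₂-trans (P ⊕ Q) θ ζ (inj₁ x) =
  trans (cong (cong inj₁) (fmap₂-trans P θ ζ x)) (sym (trans-cong (fmap₂ P θ x)))
fmap₂-trans (P ⊕ Q) θ ζ (inj₂ y) =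
  trans (cong (cong inj₂) (fmap₂-trans Q θ ζ y)) (sym (trans-cong (fmap₂ Q θ y)))
fmap₂-trans (P ⊗ Q) θ ζ (x , y) =
  trans (cong₂ (cong₂ _,_) (fmap₂-trans P θ ζ x) (fmap₂-trans Q θ ζ y))
        (sym (trans-, (fmap₂ P θ x) (fmap₂ Q θ y) (fmap₂ P ζ x) (fmap₂ Q ζ y)))

-- a commutative square of paths (a record, so that its indices can be inferred)
record Sq {A : Set} {a b c d : A} (p : a ≡ b) (q : b ≡ c) (r : a ≡ d) (s : d ≡ c) : Set where
  constructor sq
  field eq : trans p q ≡ trans r s
open Sq public

module _ {A B : Set} where
  lift₁ : {a b c d : A} {p : a ≡ b} {q : b ≡ c} {r : a ≡ d} {s : d ≡ c} →
          Sq p q r s → Sq (cong (inj₁ {B = B}) p) (cong inj₁ q) (cong inj₁ r) (cong inj₁ s)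
  lift₁ {p = p} {r = r} (sq e) = sq (trans (trans-cong p) (trans (cong (cong inj₁) e) (sym (trans-cong r))))

  lift₂ : {a b c d : B} {p : a ≡ b} {q : b ≡ c} {r : a ≡ d} {s : d ≡ c} →
          Sq p q r s → Sq (cong (inj₂ {A = A}) p) (cong inj₂ q) (cong inj₂ r) (cong inj₂ s)
  lift₂ {p = p} {r = r} (sq e) = sq (trans (trans-cong p) (trans (cong (cong inj₂) e) (sym (trans-cong r))))

  lift× : {a b c a' : A} {d e f d' : B}
          {p : a ≡ b} {q : b ≡ c} {r : a ≡ a'} {s : a' ≡ c}
          {p' : d ≡ e} {q' : e ≡ f} {r' : d ≡ d'} {s' : d' ≡ f} →
          Sq p q r s → Sq p' q' r' s' →
          Sq (cong₂ _,_ p p') (cong₂ _,_ q q') (cong₂ _,_ r r') (cong₂ _,_ s s')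
  lift× {p = p} {q} {r} {s} {p'} {q'} {r'} {s'} (sq e) (sq e') = sq
    (trans (trans-, p p' q q')
     (trans (cong₂ (cong₂ _,_) e e') (sym (trans-, r r' s s'))))

sq-r : {A : Set} {a b c d : A} {p : a ≡ b} {q : b ≡ c} {r r' : a ≡ d} {s : d ≡ c} →
       Sq p q r s → r ≡ r' → Sq p q r' s
sq-r x refl = x

sq-p : {A : Set} {a b c d : A} {p p' : a ≡ b} {q : b ≡ c} {r : a ≡ d} {s : d ≡ c} →
       Sq p q r s → p' ≡ p → Sq p' q r s
sq-p x refl = x

fmap₂-whL : (P : Code) {X Y Z : Set} (f : X → Y) {g h : Y → Z}
  (θ : ∀ y → g y ≡ h y) (x : ⟦ P ⟧ X) →
  Sq (fmap-∘ P f g x) (fmap₂ P (λ y → θ (f y)) x) (fmap₂ P θ (fmap P f x)) (fmap-∘ P f h x)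
fmap₂-whL (C Z _) f θ z = sq refl
fmap₂-whL I f θ x = sq (sym (trans-reflʳ _))
fmap₂-whL (P ⊕ Q) f θ (inj₁ x) = lift₁ (fmap₂-whL P f θ x)
fmap₂-whL (P ⊕ Q) f θ (inj₂ y) = lift₂ (fmap₂-whL Q f θ y)
fmap₂-whL (P ⊗ Q) f θ (x , y) = lift× (fmap₂-whL P f θ x) (fmap₂-whL Q f θ y)

fmap₂-whR : (P : Code) {X Y Z : Set} {f g : X → Y} (θ : ∀ x → f x ≡ g x)
  (h : Y → Z) (x : ⟦ P ⟧ X) →
  Sq (fmap-∘ P f h x) (fmap₂ P (λ y → cong h (θ y)) x) (cong (fmap P h) (fmap₂ P θ x)) (fmap-∘ P g h x)
fmap₂-whR (C Z _) θ h z = sq refl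
fmap₂-whR I θ h x = sq (sym (trans-reflʳ _))
fmap₂-whR (P ⊕ Q) θ h (inj₁ x) =
  sq-r (lift₁ (fmap₂-whR P θ h x))
        (sym (fmap-inj₁ P Q h (fmap₂ P θ x)))
fmap₂-whR (P ⊕ Q) θ h (inj₂ y) =
  sq-r (lift₂ (fmap₂-whR Q θ h y))
        (sym (fmap-inj₂ P Q h (fmap₂ Q θ y)))
fmap₂-whR (P ⊗ Q) θ h (x , y) =
  sq-r (lift× (fmap₂-whR P θ h x) (fmap₂-whR Q θ h y))
        (sym (fmap-pair P Q h (fmap₂ P θ x) (fmap₂ Q θ y)))

fmap-∘-idr : (P : Code) {X Y : Set} (f : X → Y) (x : ⟦ P ⟧ X) →
  fmap-∘ P f id x ≡ fmap-id P (fmap P f x)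
fmap-∘-idr (C Z _) f z = refl
fmap-∘-idr I f x = refl
fmap-∘-idr (P ⊕ Q) f (inj₁ x) = cong (cong inj₁) (fmap-∘-idr P f x)
fmap-∘-idr (P ⊕ Q) f (inj₂ y) = cong (cong inj₂) (fmap-∘-idr Q f y)
fmap-∘-idr (P ⊗ Q) f (x , y) = cong₂ (cong₂ _,_) (fmap-∘-idr P f x) (fmap-∘-idr Q f y)

fmap-∘-idl : (P : Code) {X Y : Set} (f : X → Y) (x : ⟦ P ⟧ X) →
  fmap-∘ P id f x ≡ cong (fmap P f) (fmap-id P x)
fmap-∘-idl (C Z _) f z = refl
fmap-∘-idl I f x = refl
fmap-∘-idl (P ⊕ Q) f (inj₁ x) =
  trans (cong (cong inj₁) (fmap-∘-idl P f x)) (sym (fmap-inj₁ P Q f (fmap-id P x)))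
fmap-∘-idl (P ⊕ Q) f (inj₂ y) =
  trans (cong (cong inj₂) (fmap-∘-idl Q f y)) (sym (fmap-inj₂ P Q f (fmap-id Q y)))
fmap-∘-idl (P ⊗ Q) f (x , y) =
  trans (cong₂ (cong₂ _,_) (fmap-∘-idl P f x) (fmap-∘-idl Q f y))
        (sym (fmap-pair P Q f (fmap-id P x) (fmap-id Q y)))

fmap-∘-assoc : (P : Code) {W X Y Z : Set} (f : W → X) (g : X → Y) (h : Y → Z)
  (x : ⟦ P ⟧ W) →
  Sq (cong (fmap P h) (fmap-∘ P f g x)) (fmap-∘ P (g ∘ f) h x) (fmap-∘ P g h (fmap P f x)) (fmap-∘ P f (h ∘ g) x)
fmap-∘-assoc (C Z _) f g h z = sq refl
fmap-∘-assoc I f g h x = sq refl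
fmap-∘-assoc (P ⊕ Q) f g h (inj₁ x) =
  sq-p (lift₁ (fmap-∘-assoc P f g h x))
        (fmap-inj₁ P Q h (fmap-∘ P f g x))
fmap-∘-assoc (P ⊕ Q) f g h (inj₂ y) =
  sq-p (lift₂ (fmap-∘-assoc Q f g h y))
        (fmap-inj₂ P Q h (fmap-∘ Q f g y))
fmap-∘-assoc (P ⊗ Q) f g h (x , y) =
  sq-p (lift× (fmap-∘-assoc P f g h x) (fmap-∘-assoc Q f g h y))
        (fmap-pair P Q h (fmap-∘ P f g x) (fmap-∘ Q f g y))

-- Path endpoints (for a point-constructor code A), from code P to code Q

data Endpoint (A : Code) : Code → Code → Set₁ where
  id-e   : {P : Code} → Endpoint A P P
  comp-e : {P Q R : Code} → Endpoint A P Q → Endpoint A Q R → Endpoint A P R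
  inl-e  : {P Q : Code} → Endpoint A P (P ⊕ Q)
  inr-e  : {P Q : Code} → Endpoint A Q (P ⊕ Q)
  pr₁-e  : {P Q : Code} → Endpoint A (P ⊗ Q) P
  pr₂-e  : {P Q : Code} → Endpoint A (P ⊗ Q) Q
  pair-e : {P Q R : Code} → Endpoint A P Q → Endpoint A P R → Endpoint A P (Q ⊗ R)
  const-e : {P : Code} {Z : Set} {hZ : is1Type Z} → Z → Endpoint A P (C Z hZ)
  fmap-e : {Z W : Set} {hZ : is1Type Z} {hW : is1Type W} →
           (Z → W) → Endpoint A (C Z hZ) (C W hW)
  constr-e : Endpoint A A I

⟦_⟧ₑ : {A P Q : Code} → Endpoint A P Q → {X : Set} → (⟦ A ⟧ X → X) → ⟦ P ⟧ X → ⟦ Q ⟧ X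
⟦ id-e ⟧ₑ c x = x
⟦ comp-e e₁ e₂ ⟧ₑ c x = ⟦ e₂ ⟧ₑ c (⟦ e₁ ⟧ₑ c x)
⟦ inl-e ⟧ₑ c x = inj₁ x
⟦ inr-e ⟧ₑ c x = inj₂ x
⟦ pr₁-e ⟧ₑ c x = proj₁ x
⟦ pr₂-e ⟧ₑ c x = proj₂ x
⟦ pair-e e₁ e₂ ⟧ₑ c x = ⟦ e₁ ⟧ₑ c x , ⟦ e₂ ⟧ₑ c x
⟦ const-e z ⟧ₑ c x = z
⟦ fmap-e g ⟧ₑ c x = g x
⟦ constr-e ⟧ₑ c x = c x

⟦_⟧₁ : {A P Q : Code} (e : Endpoint A P Q) {X Y : Set}
  {cX : ⟦ A ⟧ X → X} {cY : ⟦ A ⟧ Y → Y} (f : X → Y)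
  (fc : ∀ x → f (cX x) ≡ cY (fmap A f x)) (x : ⟦ P ⟧ X) →
  fmap Q f (⟦ e ⟧ₑ cX x) ≡ ⟦ e ⟧ₑ cY (fmap P f x)
⟦ id-e ⟧₁ f fc x = refl
⟦ comp-e e₁ e₂ ⟧₁ {cY = cY} f fc x =
  trans (⟦ e₂ ⟧₁ f fc (⟦ e₁ ⟧ₑ _ x)) (cong (⟦ e₂ ⟧ₑ cY) (⟦ e₁ ⟧₁ f fc x))
⟦ inl-e ⟧₁ f fc x = refl
⟦ inr-e ⟧₁ f fc x = refl
⟦ pr₁-e ⟧₁ f fc x = refl
⟦ pr₂-e ⟧₁ f fc x = refl
⟦ pair-e e₁ e₂ ⟧₁ f fc x = cong₂ _,_ (⟦ e₁ ⟧₁ f fc x) (⟦ e₂ ⟧₁ f fc x)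
⟦ const-e z ⟧₁ f fc x = refl
⟦ fmap-e g ⟧₁ f fc x = refl
⟦ constr-e ⟧₁ f fc x = fc x

-- Homotopy endpoints.
-- Parameters: point constructor code A; path constructors (index set J,
-- argument codes Q j, endpoints l j, r j : Q j → I); the point-argument
-- code R of the homotopy constructor and its path-argument endpoints
-- al, ar : R → I.  Index: two path endpoints s t : R → T.

module _ (A : Code) (J : Set) (Q : J → Code) (l r : (j : J) → Endpoint A (Q j) I)
         (R : Code) (al ar : Endpoint A R I) where

  data HomEndpoint : {T : Code} → Endpoint A R T → Endpoint A R T → Set₁ where
    refl-h  : {T : Code} (e : Endpoint A R T) → HomEndpoint e e
    inv-h   : {T : Code} {s t : Endpoint A R T} → HomEndpoint s t → HomEndpoint t s
    trans-h : {T : Code} {s t u : Endpoint A R T} →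
              HomEndpoint s t → HomEndpoint t u → HomEndpoint s u
    ap-h    : {T T' : Code} {s t : Endpoint A R T} (e : Endpoint A T T') →
              HomEndpoint s t → HomEndpoint (comp-e s e) (comp-e t e)
    assoc-h : {T₁ T₂ T₃ : Code} (e₁ : Endpoint A R T₁) (e₂ : Endpoint A T₁ T₂)
              (e₃ : Endpoint A T₂ T₃) →
              HomEndpoint (comp-e e₁ (comp-e e₂ e₃)) (comp-e (comp-e e₁ e₂) e₃)
    idl-h   : {T : Code} (e : Endpoint A R T) → HomEndpoint (comp-e id-e e) e
    idr-h   : {T : Code} (e : Endpoint A R T) → HomEndpoint (comp-e e id-e) e
    pr₁-h   : {T₁ T₂ : Code} (e₁ : Endpoint A R T₁) (e₂ : Endpoint A R T₂) →
              HomEndpoint (comp-e (pair-e e₁ e₂) pr₁-e) e₁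
    pr₂-h   : {T₁ T₂ : Code} (e₁ : Endpoint A R T₁) (e₂ : Endpoint A R T₂) →
              HomEndpoint (comp-e (pair-e e₁ e₂) pr₂-e) e₂
    pair-h  : {T₁ T₂ : Code} {s₁ t₁ : Endpoint A R T₁} {s₂ t₂ : Endpoint A R T₂} →
              HomEndpoint s₁ t₁ → HomEndpoint s₂ t₂ →
              HomEndpoint (pair-e s₁ s₂) (pair-e t₁ t₂)
    const-h : {T : Code} {Z : Set} {hZ : is1Type Z} (e : Endpoint A R T) (z : Z) →
              HomEndpoint (comp-e e (const-e {hZ = hZ} z)) (const-e z)
    path-arg-h : HomEndpoint al ar
    path-constr-h : (j : J) (e : Endpoint A R (Q j)) →
              HomEndpoint (comp-e e (l j)) (comp-e e (r j))

  ⟦_⟧ₕ : {T : Code} {s t : Endpoint A R T} → HomEndpoint s t →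
    {X : Set} (c : ⟦ A ⟧ X → X)
    (p : ∀ j (y : ⟦ Q j ⟧ X) → ⟦ l j ⟧ₑ c y ≡ ⟦ r j ⟧ₑ c y)
    (x : ⟦ R ⟧ X) (q : ⟦ al ⟧ₑ c x ≡ ⟦ ar ⟧ₑ c x) → ⟦ s ⟧ₑ c x ≡ ⟦ t ⟧ₑ c x
  ⟦ refl-h e ⟧ₕ c p x q = refl
  ⟦ inv-h h ⟧ₕ c p x q = sym (⟦ h ⟧ₕ c p x q)
  ⟦ trans-h h₁ h₂ ⟧ₕ c p x q = trans (⟦ h₁ ⟧ₕ c p x q) (⟦ h₂ ⟧ₕ c p x q)
  ⟦ ap-h e h ⟧ₕ c p x q = cong (⟦ e ⟧ₑ c) (⟦ h ⟧ₕ c p x q)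
  ⟦ assoc-h e₁ e₂ e₃ ⟧ₕ c p x q = refl
  ⟦ idl-h e ⟧ₕ c p x q = refl
  ⟦ idr-h e ⟧ₕ c p x q = refl
  ⟦ pr₁-h e₁ e₂ ⟧ₕ c p x q = refl
  ⟦ pr₂-h e₁ e₂ ⟧ₕ c p x q = refl
  ⟦ pair-h h₁ h₂ ⟧ₕ c p x q = cong₂ _,_ (⟦ h₁ ⟧ₕ c p x q) (⟦ h₂ ⟧ₕ c p x q)
  ⟦ const-h e z ⟧ₕ c p x q = refl
  ⟦ path-arg-h ⟧ₕ c p x q = q
  ⟦ path-constr-h j e ⟧ₕ c p x q = p j (⟦ e ⟧ₑ c x)

-- HIT-signatures

record Signature : Set₁ where
  field
    -- point constructor
    A  : Code
    -- path constructors
    J  : Set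
    Q  : J → Code
    l  : (j : J) → Endpoint A (Q j) I
    r  : (j : J) → Endpoint A (Q j) I
    -- homotopy constructors
    K  : Set
    R  : K → Code
    al : (k : K) → Endpoint A (R k) I
    ar : (k : K) → Endpoint A (R k) I
    s  : (k : K) → Endpoint A (R k) I
    t  : (k : K) → Endpoint A (R k) I
    hl : (k : K) → HomEndpoint A J Q l r (R k) (al k) (ar k) (s k) (t k)
    hr : (k : K) → HomEndpoint A J Q l r (R k) (al k) (ar k) (s k) (t k)

cong-trans : {A B : Set} (f : A → B) {a b c : A} (p : a ≡ b) (q : b ≡ c) →
  cong f (trans p q) ≡ trans (cong f p) (cong f q)
cong-trans f p q = sym (trans-cong p)

module EndpointComp {A : Code} {X Y Z : Set}
  {cX : ⟦ A ⟧ X → X} {cY : ⟦ A ⟧ Y → Y} {cZ : ⟦ A ⟧ Z → Z}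
  (f : X → Y) (fc : ∀ x → f (cX x) ≡ cY (fmap A f x))
  (g : Y → Z) (gc : ∀ y → g (cY y) ≡ cZ (fmap A g y)) where

  compc : ∀ x → g (f (cX x)) ≡ cZ (fmap A (g ∘ f) x)
  compc x = trans (cong g (fc x)) (trans (gc (fmap A f x)) (cong cZ (fmap-∘ A f g x)))

  E-comp : {P Q : Code} (e : Endpoint A P Q) (x : ⟦ P ⟧ X) →
    trans (fmap-∘ Q f g (⟦ e ⟧ₑ cX x)) (⟦ e ⟧₁ (g ∘ f) compc x)
    ≡ trans (cong (fmap Q g) (⟦ e ⟧₁ f fc x))
            (trans (⟦ e ⟧₁ g gc (fmap P f x)) (cong (⟦ e ⟧ₑ cZ) (fmap-∘ P f g x)))
  E-comp {P} id-e x = trans (trans-reflʳ _) (sym (cong-id _))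
  E-comp {P} (comp-e {Q = M} {R = Q} e₁ e₂) x = begin
      trans F∘Q (trans E2h (cong e₂Z E1h))
        ≡⟨ sym (trans-assoc F∘Q) ⟩
      trans (trans F∘Q E2h) (cong e₂Z E1h)
        ≡⟨ cong (λ z → trans z (cong e₂Z E1h)) (E-comp e₂ y) ⟩
      trans (trans (cong gQ E2f) (trans (E2g (fmap M f y)) (cong e₂Z F∘M))) (cong e₂Z E1h)
        ≡⟨ trans-assoc (cong gQ E2f) ⟩
      trans (cong gQ E2f) (trans (trans (E2g (fmap M f y)) (cong e₂Z F∘M)) (cong e₂Z E1h))
        ≡⟨ cong (trans (cong gQ E2f)) (trans-assoc (E2g (fmap M f y))) ⟩
      trans (cong gQ E2f) (trans (E2g (fmap M f y)) (trans (cong e₂Z F∘M) (cong e₂Z E1h)))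
        ≡⟨ cong (λ z → trans (cong gQ E2f) (trans (E2g (fmap M f y)) z)) (trans-cong F∘M) ⟩
      trans (cong gQ E2f) (trans (E2g (fmap M f y)) (cong e₂Z (trans F∘M E1h)))
        ≡⟨ cong (λ z → trans (cong gQ E2f) (trans (E2g (fmap M f y)) (cong e₂Z z))) (E-comp e₁ x) ⟩
      trans (cong gQ E2f) (trans (E2g (fmap M f y)) (cong e₂Z (trans (cong gM E1f) (trans E1g (cong e₁Z F∘P)))))
        ≡⟨ cong (λ z → trans (cong gQ E2f) (trans (E2g (fmap M f y)) z))
             (trans (cong-trans e₂Z (cong gM E1f) _)
                    (cong₂ trans (sym (cong-∘ E1f)) (cong-trans e₂Z E1g _))) ⟩
      trans (cong gQ E2f) (trans (E2g (fmap M f y))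
            (trans (cong (e₂Z ∘ gM) E1f) (trans (cong e₂Z E1g) (cong e₂Z (cong e₁Z F∘P)))))
        ≡⟨ cong (trans (cong gQ E2f)) (sym (trans-assoc (E2g (fmap M f y)))) ⟩
      trans (cong gQ E2f) (trans (trans (E2g (fmap M f y)) (cong (e₂Z ∘ gM) E1f))
            (trans (cong e₂Z E1g) (cong e₂Z (cong e₁Z F∘P))))
        ≡⟨ cong (λ z → trans (cong gQ E2f) (trans z (trans (cong e₂Z E1g) (cong e₂Z (cong e₁Z F∘P)))))
             (nat E2g E1f) ⟩
      trans (cong gQ E2f) (trans (trans (cong (gQ ∘ e₂Y) E1f) (E2g (⟦ e₁ ⟧ₑ cY (fmap P f x))))
            (trans (cong e₂Z E1g) (cong e₂Z (cong e₁Z F∘P))))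
        ≡⟨ cong (trans (cong gQ E2f)) (trans-assoc (cong (gQ ∘ e₂Y) E1f)) ⟩
      trans (cong gQ E2f) (trans (cong (gQ ∘ e₂Y) E1f) (trans (E2g (⟦ e₁ ⟧ₑ cY (fmap P f x)))
            (trans (cong e₂Z E1g) (cong e₂Z (cong e₁Z F∘P)))))
        ≡⟨ sym (trans-assoc (cong gQ E2f)) ⟩
      trans (trans (cong gQ E2f) (cong (gQ ∘ e₂Y) E1f)) (trans (E2g (⟦ e₁ ⟧ₑ cY (fmap P f x)))
            (trans (cong e₂Z E1g) (cong e₂Z (cong e₁Z F∘P))))
        ≡⟨ cong₂ trans
             (trans (cong (trans (cong gQ E2f)) (cong-∘ E1f))
               (trans (trans-cong E2f) (cong (cong gQ) refl)))
             (trans (sym (trans-assoc (E2g (⟦ e₁ ⟧ₑ cY (fmap P f x)))))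
               (cong (trans (trans (E2g (⟦ e₁ ⟧ₑ cY (fmap P f x))) (cong e₂Z E1g))) (sym (cong-∘ F∘P)))) ⟩
      trans (cong gQ (trans E2f (cong e₂Y E1f)))
            (trans (trans (E2g (⟦ e₁ ⟧ₑ cY (fmap P f x))) (cong e₂Z E1g)) (cong (e₂Z ∘ e₁Z) F∘P))
      ∎
    where
      open ≡-Reasoning
      y = ⟦ e₁ ⟧ₑ cX x
      gQ = fmap Q g
      gM = fmap M g
      e₁Z = ⟦ e₁ ⟧ₑ cZ
      e₂Z = ⟦ e₂ ⟧ₑ cZ
      e₂Y = ⟦ e₂ ⟧ₑ cY
      F∘Q = fmap-∘ Q f g (⟦ e₂ ⟧ₑ cX y)
      F∘M = fmap-∘ M f g y
      F∘P = fmap-∘ P f g x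
      E2h = ⟦ e₂ ⟧₁ (g ∘ f) compc y
      E1h = ⟦ e₁ ⟧₁ (g ∘ f) compc x
      E2f = ⟦ e₂ ⟧₁ f fc y
      E1f = ⟦ e₁ ⟧₁ f fc x
      E2g = ⟦ e₂ ⟧₁ g gc
      E1g = ⟦ e₁ ⟧₁ g gc (fmap P f x)
  E-comp inl-e x = trans-reflʳ _
  E-comp inr-e x = trans-reflʳ _
  E-comp {P ⊗ P'} pr₁-e x = trans (trans-reflʳ _)
    (sym (cong-proj₁ (fmap-∘ P f g (proj₁ x)) (fmap-∘ P' f g (proj₂ x))))
  E-comp {P ⊗ P'} pr₂-e x = trans (trans-reflʳ _)
    (sym (cong-proj₂ (fmap-∘ P f g (proj₁ x)) (fmap-∘ P' f g (proj₂ x))))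
  E-comp {P} {Q₁ ⊗ Q₂} (pair-e e₁ e₂) x = begin
      trans (cong₂ _,_ a₁ a₂) (cong₂ _,_ b₁ b₂)
        ≡⟨ trans-, a₁ a₂ b₁ b₂ ⟩
      cong₂ _,_ (trans a₁ b₁) (trans a₂ b₂)
        ≡⟨ cong₂ (cong₂ _,_) (E-comp e₁ x) (E-comp e₂ x) ⟩
      cong₂ _,_ (trans (cong (fmap Q₁ g) c₁) (trans d₁ (cong (⟦ e₁ ⟧ₑ cZ) F∘P)))
                (trans (cong (fmap Q₂ g) c₂) (trans d₂ (cong (⟦ e₂ ⟧ₑ cZ) F∘P)))
        ≡⟨ sym (trans-, (cong (fmap Q₁ g) c₁) (cong (fmap Q₂ g) c₂) _ _) ⟩
      trans (cong₂ _,_ (cong (fmap Q₁ g) c₁) (cong (fmap Q₂ g) c₂))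
            (cong₂ _,_ (trans d₁ (cong (⟦ e₁ ⟧ₑ cZ) F∘P)) (trans d₂ (cong (⟦ e₂ ⟧ₑ cZ) F∘P)))
        ≡⟨ cong₂ trans (sym (fmap-pair Q₁ Q₂ g c₁ c₂))
             (trans (sym (trans-, d₁ d₂ _ _)) (cong (trans (cong₂ _,_ d₁ d₂)) (sym (cong-, F∘P)))) ⟩
      trans (cong (fmap (Q₁ ⊗ Q₂) g) (cong₂ _,_ c₁ c₂))
            (trans (cong₂ _,_ d₁ d₂) (cong (⟦ pair-e e₁ e₂ ⟧ₑ cZ) F∘P))
      ∎
    where
      open ≡-Reasoning
      F∘P = fmap-∘ P f g x
      a₁ = fmap-∘ Q₁ f g (⟦ e₁ ⟧ₑ cX x)
      a₂ = fmap-∘ Q₂ f g (⟦ e₂ ⟧ₑ cX x)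
      b₁ = ⟦ e₁ ⟧₁ (g ∘ f) compc x
      b₂ = ⟦ e₂ ⟧₁ (g ∘ f) compc x
      c₁ = ⟦ e₁ ⟧₁ f fc x
      c₂ = ⟦ e₂ ⟧₁ f fc x
      d₁ = ⟦ e₁ ⟧₁ g gc (fmap P f x)
      d₂ = ⟦ e₂ ⟧₁ g gc (fmap P f x)
  E-comp {P} (const-e z) x = sym (cong-const (fmap-∘ P f g x))
  E-comp (fmap-e k) x = refl
  E-comp constr-e x = refl

module EndpointId {A : Code} {X : Set} {cX : ⟦ A ⟧ X → X} where

  idc : ∀ x → cX x ≡ cX (fmap A id x)
  idc x = cong cX (sym (fmap-id A x))

  private
    inv-cancel : {a b : ⟦ A ⟧ X} (q : a ≡ b) →
      trans (cong cX (sym q)) (cong cX q) ≡ refl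
    inv-cancel refl = refl

  E-id : {P Q : Code} (e : Endpoint A P Q) (x : ⟦ P ⟧ X) →
    trans (⟦ e ⟧₁ id idc x) (cong (⟦ e ⟧ₑ cX) (fmap-id P x)) ≡ fmap-id Q (⟦ e ⟧ₑ cX x)
  E-id id-e x = cong-id _
  E-id {P} (comp-e {Q = M} e₁ e₂) x = begin
      trans (trans E2 (cong e₂X E1)) (cong (e₂X ∘ e₁X) (fmap-id P x))
        ≡⟨ trans-assoc E2 ⟩
      trans E2 (trans (cong e₂X E1) (cong (e₂X ∘ e₁X) (fmap-id P x)))
        ≡⟨ cong (λ z → trans E2 (trans (cong e₂X E1) z)) (cong-∘ (fmap-id P x)) ⟩
      trans E2 (trans (cong e₂X E1) (cong e₂X (cong e₁X (fmap-id P x))))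
        ≡⟨ cong (trans E2) (trans-cong E1) ⟩
      trans E2 (cong e₂X (trans E1 (cong e₁X (fmap-id P x))))
        ≡⟨ cong (λ z → trans E2 (cong e₂X z)) (E-id e₁ x) ⟩
      trans E2 (cong e₂X (fmap-id M (e₁X x)))
        ≡⟨ E-id e₂ (e₁X x) ⟩
      _ ∎
    where
      open ≡-Reasoning
      e₁X = ⟦ e₁ ⟧ₑ cX
      e₂X = ⟦ e₂ ⟧ₑ cX
      E1 = ⟦ e₁ ⟧₁ id idc x
      E2 = ⟦ e₂ ⟧₁ id idc (e₁X x)
  E-id inl-e x = refl
  E-id inr-e x = refl
  E-id {P ⊗ P'} pr₁-e x = cong-proj₁ (fmap-id P (proj₁ x)) (fmap-id P' (proj₂ x))
  E-id {P ⊗ P'} pr₂-e x = cong-proj₂ (fmap-id P (proj₁ x)) (fmap-id P' (proj₂ x))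
  E-id {P} (pair-e e₁ e₂) x =
    trans (cong (trans (cong₂ _,_ _ _)) (cong-, (fmap-id P x)))
     (trans (trans-, (⟦ e₁ ⟧₁ id idc x) (⟦ e₂ ⟧₁ id idc x) (cong (⟦ e₁ ⟧ₑ cX) (fmap-id P x)) (cong (⟦ e₂ ⟧ₑ cX) (fmap-id P x)))
       (cong₂ (cong₂ _,_) (E-id e₁ x) (E-id e₂ x)))
  E-id {P} (const-e z) x = cong-const (fmap-id P x)
  E-id (fmap-e k) x = refl
  E-id constr-e x = inv-cancel (fmap-id A x)

private
  id-field : {B W : Set} {L R : B → W} (p : ∀ w → L w ≡ R w) {u u' : B} (q : u' ≡ u)
    (El : L u ≡ L u') (Er : R u ≡ R u') →
    trans El (cong L q) ≡ refl → trans Er (cong R q) ≡ refl →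
    trans (cong id (p u)) Er ≡ trans El (p u')
  id-field p {u} refl El Er hl hr =
    trans (cong (trans (cong id (p u))) Er≡refl)
     (trans (trans-reflʳ _) (trans (cong-id _) (cong (λ z → trans z (p u)) (sym El≡refl))))
    where
      El≡refl = trans (sym (trans-reflʳ El)) hl
      Er≡refl = trans (sym (trans-reflʳ Er)) hr

  comp-field : {X Y Z B : Set} (f : X → Y) (g : Y → Z) {L R : B → Z}
    (pZ : ∀ w → L w ≡ R w)
    {a b : X} (pX : a ≡ b) {a' b' : Y} (Elf : f a ≡ a') (Erf : f b ≡ b') (pY : a' ≡ b')
    (Pf : trans (cong f pX) Erf ≡ trans Elf pY)
    {w w' : B} (Elg : g a' ≡ L w) (Erg : g b' ≡ R w)
    (Pg : trans (cong g pY) Erg ≡ trans Elg (pZ w))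
    (q : w ≡ w') →
    trans (cong (g ∘ f) pX) (trans (cong g Erf) (trans Erg (cong R q)))
    ≡ trans (trans (cong g Elf) (trans Elg (cong L q))) (pZ w')
  comp-field f g pZ pX Elf Erf pY Pf {w} Elg Erg Pg refl = begin
      trans (cong (g ∘ f) pX) (trans (cong g Erf) (trans Erg refl))
        ≡⟨ cong₂ trans (cong-∘ pX) (cong (trans (cong g Erf)) (trans-reflʳ Erg)) ⟩
      trans (cong g (cong f pX)) (trans (cong g Erf) Erg)
        ≡⟨ sym (trans-assoc (cong g (cong f pX))) ⟩
      trans (trans (cong g (cong f pX)) (cong g Erf)) Erg
        ≡⟨ cong (λ z → trans z Erg) (trans (trans-cong (cong f pX)) (cong (cong g) Pf)) ⟩
      trans (cong g (trans Elf pY)) Erg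
        ≡⟨ cong (λ z → trans z Erg) (sym (trans-cong Elf)) ⟩
      trans (trans (cong g Elf) (cong g pY)) Erg
        ≡⟨ trans-assoc (cong g Elf) ⟩
      trans (cong g Elf) (trans (cong g pY) Erg)
        ≡⟨ cong (trans (cong g Elf)) Pg ⟩
      trans (cong g Elf) (trans Elg (pZ w))
        ≡⟨ sym (trans-assoc (cong g Elf)) ⟩
      trans (trans (cong g Elf) Elg) (pZ w)
        ≡⟨ cong (λ z → trans (trans (cong g Elf) z) (pZ w)) (sym (trans-reflʳ Elg)) ⟩
      trans (trans (cong g Elf) (trans Elg refl)) (pZ w)
      ∎
    where open ≡-Reasoning

record Alg (S : Signature) : Set₁ where
  open Signature S
  field
    carrier : Set
    trunc   : is1Type carrier
    c       : ⟦ A ⟧ carrier → carrier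
    p       : (j : J) (x : ⟦ Q j ⟧ carrier) → ⟦ l j ⟧ₑ c x ≡ ⟦ r j ⟧ₑ c x
    h       : (k : K) (x : ⟦ R k ⟧ carrier) (q : ⟦ al k ⟧ₑ c x ≡ ⟦ ar k ⟧ₑ c x) →
              ⟦_⟧ₕ A J Q l r (R k) (al k) (ar k) (hl k) c p x q
              ≡ ⟦_⟧ₕ A J Q l r (R k) (al k) (ar k) (hr k) c p x q

module _ {S : Signature} where
  open Signature S
  open Alg

  record _⟶_ (X Y : Alg S) : Set where
    field
      fun   : carrier X → carrier Y
      fun-c : (x : ⟦ A ⟧ (carrier X)) → fun (c X x) ≡ c Y (fmap A fun x)
      fun-p : (j : J) (x : ⟦ Q j ⟧ (carrier X)) →
              trans (cong fun (p X j x)) (⟦ r j ⟧₁ fun fun-c x)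
              ≡ trans (⟦ l j ⟧₁ fun fun-c x) (p Y j (fmap (Q j) fun x))
  open _⟶_ public

  infix 4 _⇒_ _≈₂_

  record _⇒_ {X Y : Alg S} (f g : X ⟶ Y) : Set where
    field
      hom   : (x : carrier X) → fun f x ≡ fun g x
      hom-c : (x : ⟦ A ⟧ (carrier X)) →
              trans (hom (c X x)) (fun-c g x)
              ≡ trans (fun-c f x) (cong (c Y) (fmap₂ A hom x))
  open _⇒_ public

  _≈₂_ : {X Y : Alg S} {f g : X ⟶ Y} → f ⇒ g → f ⇒ g → Set
  _≈₂_ {X} θ ζ = (x : carrier X) → hom θ x ≡ hom ζ x

  id₁ : (X : Alg S) → X ⟶ X
  id₁ X = record
    { fun = id
    ; fun-c = idc
    ; fun-p = λ j x → id-field (p X j) (fmap-id (Q j) x)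
                (⟦ l j ⟧₁ id idc x) (⟦ r j ⟧₁ id idc x)
                (E-id (l j) x) (E-id (r j) x)
    }
    where open EndpointId {A = A} {cX = c X}

  -- composition of 1-cells, in diagrammatic order:  f · g  is  "first f, then g"
  infixl 20 _·_
  _·_ : {X Y Z : Alg S} → X ⟶ Y → Y ⟶ Z → X ⟶ Z
  _·_ {X} {Y} {Z} f g = record
    { fun = fun g ∘ fun f
    ; fun-c = compc
    ; fun-p = λ j x →
        trans (cong (trans (cong (fun g ∘ fun f) (p X j x))) (E-comp (r j) x))
         (trans (comp-field (fun f) (fun g) (p Z j) (p X j x)
                   (⟦ l j ⟧₁ (fun f) (fun-c f) x) (⟦ r j ⟧₁ (fun f) (fun-c f) x)
                   (p Y j (fmap (Q j) (fun f) x)) (fun-p f j x)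
                   (⟦ l j ⟧₁ (fun g) (fun-c g) (fmap (Q j) (fun f) x))
                   (⟦ r j ⟧₁ (fun g) (fun-c g) (fmap (Q j) (fun f) x))
                   (fun-p g j (fmap (Q j) (fun f) x))
                   (fmap-∘ (Q j) (fun f) (fun g) x))
          (cong (λ z → trans z (p Z j (fmap (Q j) (fun g ∘ fun f) x))) (sym (E-comp (l j) x))))
    }
    where open EndpointComp {A = A} {cX = c X} {cY = c Y} {cZ = c Z} (fun f) (fun-c f) (fun g) (fun-c g)

private
  refl-law : {Y : Set} {a u : Y} (φ ψ : a ≡ u) (e : φ ≡ ψ) (ρ : u ≡ u) → ρ ≡ refl →
    trans refl ψ ≡ trans φ ρ
  refl-law φ ψ e ρ h =
    trans (sym e) (trans (sym (trans-reflʳ φ)) (cong (trans φ) (sym h)))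

  ru-lemma : {Y B : Set} (cY : B → Y) {a : Y} {u v : B} (φ : a ≡ cY v) (q q' : u ≡ v) →
    q' ≡ q → trans (cong id φ) (trans (cong cY (sym q)) (cong cY q')) ≡ φ
  ru-lemma cY φ refl .refl refl = trans (trans-reflʳ _) (cong-id φ)

  lu-lemma : {X Y B B' : Set} (f : X → Y) (cX : B → X) (cY : B' → Y) (fA : B → B')
    (fc : ∀ x → f (cX x) ≡ cY (fA x)) {u v : B} (q : u ≡ v) (q' : fA u ≡ fA v) →
    q' ≡ cong fA q →
    trans (cong f (cong cX (sym q))) (trans (fc u) (cong cY q')) ≡ fc v
  lu-lemma f cX cY fA fc {u} refl .refl refl = trans-reflʳ (fc u)

  assoc-lemma : {Y Z W Bz Bw : Set} (g : Y → Z) (h : Z → W) (cZ : Bz → Z) (cW : Bw → W)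
    (hA : Bz → Bw) (hc : ∀ z → h (cZ z) ≡ cW (hA z))
    {a b : Y} (α : a ≡ b) {m v : Bz} (β : g b ≡ cZ m) (q : m ≡ v)
    {u v' : Bw} (r₁ : hA v ≡ v') (r₂ : hA m ≡ u) (r₃ : u ≡ v')
    (e : trans (cong hA q) r₁ ≡ trans r₂ r₃) →
    trans (cong h (trans (cong g α) (trans β (cong cZ q)))) (trans (hc v) (cong cW r₁))
    ≡ trans (cong (h ∘ g) α) (trans (trans (cong h β) (trans (hc m) (cong cW r₂))) (cong cW r₃))
  assoc-lemma g h cZ cW hA hc refl β refl r₁ r₂ r₃ e =
    trans (cong (λ z → trans (cong h (trans β refl)) (trans (hc _) (cong cW z))) e)
          (inner r₂ r₃)
    where
      inner : ∀ {u v'} (r₂ : hA _ ≡ u) (r₃ : u ≡ v') →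
        trans (cong h (trans β refl)) (trans (hc _) (cong cW (trans r₂ r₃)))
        ≡ trans refl (trans (trans (cong h β) (trans (hc _) (cong cW r₂))) (cong cW r₃))
      inner refl refl =
        trans (cong₂ trans (cong (cong h) (trans-reflʳ β)) (trans-reflʳ (hc _)))
              (sym (trans (trans-reflʳ _) (cong (trans (cong h β)) (trans-reflʳ (hc _)))))

  lw-lemma : {Y Z Bz : Set} {g h : Y → Z} (θ : ∀ y → g y ≡ h y) (cZ : Bz → Z)
    {a b : Y} (α : a ≡ b) {m₁ m₂ n k : Bz}
    (hc' : h b ≡ cZ m₁) (gc' : g b ≡ cZ m₂) (ψ : m₂ ≡ m₁)
    (Hθ : trans (θ b) hc' ≡ trans gc' (cong cZ ψ))
    (s₁ : m₁ ≡ n) (s₂ : m₂ ≡ k) (t : k ≡ n) (Hs : trans s₂ t ≡ trans ψ s₁) →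
    trans (θ a) (trans (cong h α) (trans hc' (cong cZ s₁)))
    ≡ trans (trans (cong g α) (trans gc' (cong cZ s₂))) (cong cZ t)
  lw-lemma θ cZ refl hc' gc' ψ Hθ s₁ refl t Hs =
    trans (inner s₁) (cong (λ z → trans (trans gc' refl) (cong cZ z)) (sym Hs))
    where
      inner : ∀ {n} (s₁ : _ ≡ n) →
        trans (θ _) (trans hc' (cong cZ s₁)) ≡ trans (trans gc' refl) (cong cZ (trans ψ s₁))
      inner refl = trans (cong (trans (θ _)) (trans-reflʳ hc'))
                    (trans Hθ (cong₂ trans (sym (trans-reflʳ gc')) (cong (cong cZ) (sym (trans-reflʳ ψ)))))

  rw-lemma : {Y Z By Bz : Set} (h : Y → Z) (cY : By → Y) (cZ : Bz → Z) (hA : By → Bz)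
    (hc : ∀ y → h (cY y) ≡ cZ (hA y))
    {a a' : Y} {u v : By} (θc : a ≡ a') (gc' : a' ≡ cY v) (fc' : a ≡ cY u) (ψ : u ≡ v)
    (Hθ : trans θc gc' ≡ trans fc' (cong cY ψ))
    {n k : Bz} (s₁ : hA v ≡ n) (s₂ : hA u ≡ k) (t : k ≡ n)
    (Hs : trans s₂ t ≡ trans (cong hA ψ) s₁) →
    trans (cong h θc) (trans (cong h gc') (trans (hc v) (cong cZ s₁)))
    ≡ trans (trans (cong h fc') (trans (hc u) (cong cZ s₂))) (cong cZ t)
  rw-lemma h cY cZ hA hc {u = u} refl gc' fc' refl Hθ s₁ refl t Hs =
    trans (cong (λ z → trans (cong h z) (trans (hc u) (cong cZ s₁))) (trans Hθ (trans-reflʳ fc')))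
     (trans (inner s₁) (cong (λ z → trans (trans (cong h fc') (trans (hc u) refl)) (cong cZ z)) (sym Hs)))
    where
      inner : ∀ {n} (s₁ : hA u ≡ n) →
        trans (cong h fc') (trans (hc u) (cong cZ s₁))
        ≡ trans (trans (cong h fc') (trans (hc u) refl)) (cong cZ s₁)
      inner refl = sym (trans-reflʳ _)

module _ {S : Signature} where
  open Signature S
  open Alg

  id₂ : {X Y : Alg S} (f : X ⟶ Y) → f ⇒ f
  id₂ {X} {Y} f = record
    { hom = λ _ → refl
    ; hom-c = λ x → refl-law (fun-c f x) (fun-c f x) refl _ (cong (cong (c Y)) (fmap₂-refl A x))
    }

  infixl 15 _∙₂_
  _∙₂_ : {X Y : Alg S} {f g h : X ⟶ Y} → f ⇒ g → g ⇒ h → f ⇒ h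
  _∙₂_ {X} {Y} {f} {g} {h} θ ζ = record
    { hom = λ x → trans (hom θ x) (hom ζ x)
    ; hom-c = λ x → begin
        trans (trans (hom θ (c X x)) (hom ζ (c X x))) (fun-c h x)
          ≡⟨ trans-assoc (hom θ (c X x)) ⟩
        trans (hom θ (c X x)) (trans (hom ζ (c X x)) (fun-c h x))
          ≡⟨ cong (trans (hom θ (c X x))) (hom-c ζ x) ⟩
        trans (hom θ (c X x)) (trans (fun-c g x) (cong (c Y) (fmap₂ A (hom ζ) x)))
          ≡⟨ sym (trans-assoc (hom θ (c X x))) ⟩
        trans (trans (hom θ (c X x)) (fun-c g x)) (cong (c Y) (fmap₂ A (hom ζ) x))
          ≡⟨ cong (λ z → trans z (cong (c Y) (fmap₂ A (hom ζ) x))) (hom-c θ x) ⟩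
        trans (trans (fun-c f x) (cong (c Y) (fmap₂ A (hom θ) x))) (cong (c Y) (fmap₂ A (hom ζ) x))
          ≡⟨ trans-assoc (fun-c f x) ⟩
        trans (fun-c f x) (trans (cong (c Y) (fmap₂ A (hom θ) x)) (cong (c Y) (fmap₂ A (hom ζ) x)))
          ≡⟨ cong (trans (fun-c f x)) (trans (trans-cong (fmap₂ A (hom θ) x))
                 (cong (cong (c Y)) (sym (fmap₂-trans A (hom θ) (hom ζ) x)))) ⟩
        trans (fun-c f x) (cong (c Y) (fmap₂ A (λ y → trans (hom θ y) (hom ζ y)) x))
        ∎
    }
    where open ≡-Reasoning

  infixr 16 _◃_
  _◃_ : {X Y Z : Alg S} (f : X ⟶ Y) {g h : Y ⟶ Z} → g ⇒ h → f · g ⇒ f · h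
  _◃_ {X} {Y} {Z} f {g} {h} θ = record
    { hom = λ x → hom θ (fun f x)
    ; hom-c = λ x → lw-lemma (hom θ) (c Z) (fun-c f x)
        (fun-c h (fmap A (fun f) x)) (fun-c g (fmap A (fun f) x))
        (fmap₂ A (hom θ) (fmap A (fun f) x)) (hom-c θ (fmap A (fun f) x))
        (fmap-∘ A (fun f) (fun h) x) (fmap-∘ A (fun f) (fun g) x)
        (fmap₂ A (λ y → hom θ (fun f y)) x) (eq (fmap₂-whL A (fun f) (hom θ) x))
    }

  infixl 16 _▹_
  _▹_ : {X Y Z : Alg S} {f g : X ⟶ Y} → f ⇒ g → (h : Y ⟶ Z) → f · h ⇒ g · h
  _▹_ {X} {Y} {Z} {f} {g} θ h = record
    { hom = λ x → cong (fun h) (hom θ x)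
    ; hom-c = λ x → rw-lemma (fun h) (c Y) (c Z) (fmap A (fun h)) (fun-c h)
        (hom θ (c X x)) (fun-c g x) (fun-c f x) (fmap₂ A (hom θ) x) (hom-c θ x)
        (fmap-∘ A (fun g) (fun h) x) (fmap-∘ A (fun f) (fun h) x)
        (fmap₂ A (λ y → cong (fun h) (hom θ y)) x) (eq (fmap₂-whR A (hom θ) (fun h) x))
    }

  runitor : {X Y : Alg S} (f : X ⟶ Y) → f · id₁ Y ⇒ f
  runitor {X} {Y} f = record
    { hom = λ _ → refl
    ; hom-c = λ x → refl-law _ _
        (ru-lemma (c Y) (fun-c f x) (fmap-id A (fmap A (fun f) x)) (fmap-∘ A (fun f) id x)
                  (fmap-∘-idr A (fun f) x)) _ (cong (cong (c Y)) (fmap₂-refl A x))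
    }

  rinvunitor : {X Y : Alg S} (f : X ⟶ Y) → f ⇒ f · id₁ Y
  rinvunitor {X} {Y} f = record
    { hom = λ _ → refl
    ; hom-c = λ x → refl-law _ _
        (sym (ru-lemma (c Y) (fun-c f x) (fmap-id A (fmap A (fun f) x)) (fmap-∘ A (fun f) id x)
                  (fmap-∘-idr A (fun f) x))) _ (cong (cong (c Y)) (fmap₂-refl A x))
    }

  lunitor : {X Y : Alg S} (f : X ⟶ Y) → id₁ X · f ⇒ f
  lunitor {X} {Y} f = record
    { hom = λ _ → refl
    ; hom-c = λ x → refl-law _ _
        (lu-lemma (fun f) (c X) (c Y) (fmap A (fun f)) (fun-c f) (fmap-id A x)
                  (fmap-∘ A id (fun f) x) (fmap-∘-idl A (fun f) x)) _
        (cong (cong (c Y)) (fmap₂-refl A x))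
    }

  linvunitor : {X Y : Alg S} (f : X ⟶ Y) → f ⇒ id₁ X · f
  linvunitor {X} {Y} f = record
    { hom = λ _ → refl
    ; hom-c = λ x → refl-law _ _
        (sym (lu-lemma (fun f) (c X) (c Y) (fmap A (fun f)) (fun-c f) (fmap-id A x)
                  (fmap-∘ A id (fun f) x) (fmap-∘-idl A (fun f) x))) _
        (cong (cong (c Y)) (fmap₂-refl A x))
    }

  private
    assoc-c : {W X Y Z : Alg S} (f : W ⟶ X) (g : X ⟶ Y) (h : Y ⟶ Z) (x : ⟦ A ⟧ (carrier W)) →
      fun-c ((f · g) · h) x ≡ fun-c (f · (g · h)) x
    assoc-c {W} {X} {Y} {Z} f g h x =
      assoc-lemma (fun g) (fun h) (c Y) (c Z) (fmap A (fun h)) (fun-c h)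
        (fun-c f x) (fun-c g (fmap A (fun f) x)) (fmap-∘ A (fun f) (fun g) x)
        (fmap-∘ A (fun g ∘ fun f) (fun h) x) (fmap-∘ A (fun g) (fun h) (fmap A (fun f) x))
        (fmap-∘ A (fun f) (fun h ∘ fun g) x) (eq (fmap-∘-assoc A (fun f) (fun g) (fun h) x))

  rassociator : {W X Y Z : Alg S} (f : W ⟶ X) (g : X ⟶ Y) (h : Y ⟶ Z) →
    (f · g) · h ⇒ f · (g · h)
  rassociator {W} {X} {Y} {Z} f g h = record
    { hom = λ _ → refl
    ; hom-c = λ x → refl-law _ _ (assoc-c f g h x) _ (cong (cong (c Z)) (fmap₂-refl A x))
    }

  lassociator : {W X Y Z : Alg S} (f : W ⟶ X) (g : X ⟶ Y) (h : Y ⟶ Z) →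
    f · (g · h) ⇒ (f · g) · h
  lassociator {W} {X} {Y} {Z} f g h = record
    { hom = λ _ → refl
    ; hom-c = λ x → refl-law _ _ (sym (assoc-c f g h x)) _ (cong (cong (c Z)) (fmap₂-refl A x))
    }

-- Adjoint equivalences

-- in the bicategory of 1-types: 1-cells are maps, 2-cells homotopies
-- (unitors and associators are trivial, whiskering is ap / precomposition)
record IsAdjEquivType {X Y : Set} (f : X → Y) : Set where
  field
    inv  : Y → X
    η    : (x : X) → x ≡ inv (f x)
    ε    : (y : Y) → f (inv y) ≡ y
    tri₁ : (x : X) → trans (cong f (η x)) (ε (f x)) ≡ refl
    tri₂ : (y : Y) → trans (η (inv y)) (cong inv (ε y)) ≡ refl

module _ {S : Signature} where

  record IsInvertible₂ {X Y : Alg S} {f g : X ⟶ Y} (θ : f ⇒ g) : Set where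
    field
      inv₂      : g ⇒ f
      inv₂-left  : θ ∙₂ inv₂ ≈₂ id₂ f
      inv₂-right : inv₂ ∙₂ θ ≈₂ id₂ g

  record IsAdjEquivAlg {X Y : Alg S} (f : X ⟶ Y) : Set where
    field
      radj       : Y ⟶ X
      unit       : id₁ X ⇒ f · radj
      counit     : radj · f ⇒ id₁ Y
      unit-inv   : IsInvertible₂ unit
      counit-inv : IsInvertible₂ counit
      triangle₁  : linvunitor f ∙₂ (unit ▹ f) ∙₂ rassociator f radj f
                     ∙₂ (f ◃ counit) ∙₂ runitor f
                   ≈₂ id₂ f
      triangle₂  : rinvunitor radj ∙₂ (radj ◃ unit) ∙₂ lassociator radj f radj
                     ∙₂ (counit ▹ radj) ∙₂ lunitor radj
                   ≈₂ id₂ radj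

{-# OPTIONS --without-K #-}
-- Since F = fun f is an equivalence of types, cong F is a bijection on path
-- spaces, so F reflects the equations that make a map a 1-cell and a homotopy
-- a 2-cell of Alg(Σ).  The inverse g = inv gets its point structure by solving
-- the counit square through cong F.  The path law of g is reflected from that
-- of F ∘ g, which in turn is transported from the identity morphism along the
-- counit ε, using naturality of the endpoint action.  The unit is a 2-cell since
-- cong F ∘ η is the 2-cell f ◃ ε⁻¹ by the first triangle identity of types.
-- Invertibility and the triangle identities are checked on components, where
-- they are those of the equivalence of types.
module Submission where

open import Defs
open import Data.Sum using (inj₁; inj₂)
open import Data.Product using (_,_)
open import Function using (_∘_; id)
open import Function.Definitions using (Injective)
open import Relation.Binary.PropositionalEquality
  using (_≡_; refl; sym; trans; cong; cong₂; module ≡-Reasoning)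
open import Relation.Binary.PropositionalEquality.Properties
  using ( trans-reflʳ; trans-assoc; cong-id; cong-∘; trans-cong; trans-symʳ; trans-symˡ
        ; sym-cong; trans-injectiveˡ)

module _ {B : Set} where

  inverseˡ-unique : {a b : B} (p : a ≡ b) (q : b ≡ a) → trans p q ≡ refl → p ≡ sym q
  inverseˡ-unique p refl e = trans (sym (trans-reflʳ p)) e

  inverseʳ-unique : {a b : B} (p : a ≡ b) (q : b ≡ a) → trans p q ≡ refl → q ≡ sym p
  inverseʳ-unique refl q e = e

  trans-sym-trans-cancel : {a b c d : B} (L : a ≡ d) (R : b ≡ c) (E : c ≡ d) →
    trans (trans (trans L (sym (trans R E))) R) E ≡ L
  trans-sym-trans-cancel L refl refl =
    trans (trans-reflʳ _) (trans (trans-reflʳ _) (trans-reflʳ L))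

CongInjective : {X Y : Set} → (X → Y) → Set
CongInjective F = ∀ {a b} → Injective _≡_ _≡_ (cong F {a} {b})

module IsAdjEquivTypeProperties {X Y : Set} {F : X → Y} (E : IsAdjEquivType F) where
  open IsAdjEquivType E

  cong-η : (x : X) → cong F (η x) ≡ sym (ε (F x))
  cong-η x = inverseˡ-unique _ _ (tri₁ x)

  cong-sym-η : (x : X) → cong F (sym (η x)) ≡ ε (F x)
  cong-sym-η x = sym (trans (inverseʳ-unique _ _ (tri₁ x)) (sym-cong (η x)))

  cong⁻¹ : {a b : X} → F a ≡ F b → a ≡ b
  cong⁻¹ {a} {b} w = trans (η a) (trans (cong inv w) (sym (η b)))

  cong⁻¹-cong : {a b : X} (u : a ≡ b) → cong⁻¹ (cong F u) ≡ u
  cong⁻¹-cong {a} refl = trans-symʳ (η a)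

  cong-cong⁻¹ : {a b : X} (w : F a ≡ F b) → cong F (cong⁻¹ w) ≡ w
  cong-cong⁻¹ {a} {b} w = begin
      cong F (trans (η a) (trans (cong inv w) (sym (η b))))
        ≡⟨ trans (cong-trans F (η a) _) (cong (trans (cong F (η a))) (cong-trans F (cong inv w) _)) ⟩
      trans (cong F (η a)) (trans (cong F (cong inv w)) (cong F (sym (η b))))
        ≡⟨ cong₂ trans (cong-η a) (cong₂ trans (sym (cong-∘ w)) (cong-sym-η b)) ⟩
      trans (sym (ε (F a))) (trans (cong (F ∘ inv) w) (ε (F b)))
        ≡⟨ ε-conjugate w ⟩
      w ∎
    where
      open ≡-Reasoning
      ε-conjugate : {y y' : Y} (w : y ≡ y') → trans (sym (ε y)) (trans (cong (F ∘ inv) w) (ε y')) ≡ w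
      ε-conjugate {y} refl = trans-symˡ (ε y)

  cong-injective : CongInjective F
  cong-injective {x = u} {v} e = trans (sym (cong⁻¹-cong u)) (trans (cong cong⁻¹ e) (cong⁻¹-cong v))

fmap₂-cong : (P : Code) {X Y : Set} {f g : X → Y} (θ θ' : ∀ x → f x ≡ g x) →
  (∀ x → θ x ≡ θ' x) → ∀ x → fmap₂ P θ x ≡ fmap₂ P θ' x
fmap₂-cong (C Z _) θ θ' H z = refl
fmap₂-cong I θ θ' H x = H x
fmap₂-cong (P ⊕ Q) θ θ' H (inj₁ x) = cong (cong inj₁) (fmap₂-cong P θ θ' H x)
fmap₂-cong (P ⊕ Q) θ θ' H (inj₂ x) = cong (cong inj₂) (fmap₂-cong Q θ θ' H x)
fmap₂-cong (P ⊗ Q) θ θ' H (x , y) = cong₂ (cong₂ _,_) (fmap₂-cong P θ θ' H x) (fmap₂-cong Q θ θ' H y)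

fmap₂-sym : (P : Code) {X Y : Set} {f g : X → Y} (θ : ∀ x → f x ≡ g x) (x : ⟦ P ⟧ X) →
  fmap₂ P (λ y → sym (θ y)) x ≡ sym (fmap₂ P θ x)
fmap₂-sym P θ x = inverseʳ-unique (fmap₂ P θ x) _
  (trans (sym (fmap₂-trans P θ (λ y → sym (θ y)) x))
   (trans (fmap₂-cong P _ (λ _ → refl) (λ y → trans-symʳ (θ y)) x) (fmap₂-refl P x)))

paste-squares : {Y B : Set} (g : B → Y) {a b : Y} {m n o o' : B}
  (Φ : a ≡ b) (E₂v : b ≡ g n) (E₂u : a ≡ g m) (Ψ : m ≡ n)
  (E₁v : n ≡ o) (E₁u : m ≡ o') (Ψ' : o' ≡ o) →
  trans Φ E₂v ≡ trans E₂u (cong g Ψ) → trans Ψ E₁v ≡ trans E₁u Ψ' →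
  trans Φ (trans E₂v (cong g E₁v)) ≡ trans (trans E₂u (cong g E₁u)) (cong g Ψ')
paste-squares g Φ E₂v E₂u Ψ E₁v E₁u Ψ' H₂ H₁ = begin
    trans Φ (trans E₂v (cong g E₁v))
      ≡⟨ sym (trans-assoc Φ) ⟩
    trans (trans Φ E₂v) (cong g E₁v)
      ≡⟨ cong (λ z → trans z (cong g E₁v)) H₂ ⟩
    trans (trans E₂u (cong g Ψ)) (cong g E₁v)
      ≡⟨ trans-assoc E₂u ⟩
    trans E₂u (trans (cong g Ψ) (cong g E₁v))
      ≡⟨ cong (trans E₂u) (trans (trans-cong Ψ) (cong (cong g) H₁)) ⟩
    trans E₂u (cong g (trans E₁u Ψ'))
      ≡⟨ cong (trans E₂u) (cong-trans g E₁u Ψ') ⟩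
    trans E₂u (trans (cong g E₁u) (cong g Ψ'))
      ≡⟨ sym (trans-assoc E₂u) ⟩
    trans (trans E₂u (cong g E₁u)) (cong g Ψ')
    ∎
  where open ≡-Reasoning

module EndpointNat {A : Code} {X Y : Set} {cX : ⟦ A ⟧ X → X} {cY : ⟦ A ⟧ Y → Y}
  (u v : X → Y) (uc : ∀ x → u (cX x) ≡ cY (fmap A u x)) (vc : ∀ x → v (cX x) ≡ cY (fmap A v x))
  (θ : ∀ x → u x ≡ v x)
  (Hθ : ∀ x → trans (θ (cX x)) (vc x) ≡ trans (uc x) (cong cY (fmap₂ A θ x))) where

  E-nat : {P Q : Code} (e : Endpoint A P Q) (x : ⟦ P ⟧ X) →
    trans (fmap₂ Q θ (⟦ e ⟧ₑ cX x)) (⟦ e ⟧₁ v vc x)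
    ≡ trans (⟦ e ⟧₁ u uc x) (cong (⟦ e ⟧ₑ cY) (fmap₂ P θ x))
  E-nat id-e x = trans (trans-reflʳ _) (sym (cong-id _))
  E-nat {P} {Q} (comp-e {Q = M} e₁ e₂) x =
    trans (paste-squares (⟦ e₂ ⟧ₑ cY) (fmap₂ Q θ (⟦ e₂ ⟧ₑ cX y))
             (⟦ e₂ ⟧₁ v vc y) (⟦ e₂ ⟧₁ u uc y) (fmap₂ M θ y) (⟦ e₁ ⟧₁ v vc x) (⟦ e₁ ⟧₁ u uc x)
             (cong (⟦ e₁ ⟧ₑ cY) (fmap₂ P θ x))
             (E-nat e₂ y) (E-nat e₁ x))
      (cong (trans (trans (⟦ e₂ ⟧₁ u uc y) (cong (⟦ e₂ ⟧ₑ cY) (⟦ e₁ ⟧₁ u uc x))))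
            (sym (cong-∘ (fmap₂ P θ x))))
    where y = ⟦ e₁ ⟧ₑ cX x
  E-nat inl-e x = trans-reflʳ _
  E-nat inr-e x = trans-reflʳ _
  E-nat {P ⊗ P'} pr₁-e (x₁ , x₂) =
    trans (trans-reflʳ _) (sym (cong-proj₁ (fmap₂ P θ x₁) (fmap₂ P' θ x₂)))
  E-nat {P ⊗ P'} pr₂-e (x₁ , x₂) =
    trans (trans-reflʳ _) (sym (cong-proj₂ (fmap₂ P θ x₁) (fmap₂ P' θ x₂)))
  E-nat {P} {Q₁ ⊗ Q₂} (pair-e e₁ e₂) x = begin
      trans (cong₂ _,_ a₁ a₂) (cong₂ _,_ b₁ b₂)
        ≡⟨ trans-, a₁ a₂ b₁ b₂ ⟩
      cong₂ _,_ (trans a₁ b₁) (trans a₂ b₂)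
        ≡⟨ cong₂ (cong₂ _,_) (E-nat e₁ x) (E-nat e₂ x) ⟩
      cong₂ _,_ (trans c₁ (cong (⟦ e₁ ⟧ₑ cY) Φ)) (trans c₂ (cong (⟦ e₂ ⟧ₑ cY) Φ))
        ≡⟨ sym (trans-, c₁ c₂ _ _) ⟩
      trans (cong₂ _,_ c₁ c₂) (cong₂ _,_ (cong (⟦ e₁ ⟧ₑ cY) Φ) (cong (⟦ e₂ ⟧ₑ cY) Φ))
        ≡⟨ cong (trans (cong₂ _,_ c₁ c₂)) (sym (cong-, Φ)) ⟩
      trans (cong₂ _,_ c₁ c₂) (cong (⟦ pair-e e₁ e₂ ⟧ₑ cY) Φ)
      ∎
    where
      open ≡-Reasoning
      Φ = fmap₂ P θ x
      a₁ = fmap₂ Q₁ θ (⟦ e₁ ⟧ₑ cX x)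
      a₂ = fmap₂ Q₂ θ (⟦ e₂ ⟧ₑ cX x)
      b₁ = ⟦ e₁ ⟧₁ v vc x
      b₂ = ⟦ e₂ ⟧₁ v vc x
      c₁ = ⟦ e₁ ⟧₁ u uc x
      c₂ = ⟦ e₂ ⟧₁ u uc x
  E-nat {P} (const-e z) x = sym (cong-const (fmap₂ P θ x))
  E-nat (fmap-e k) x = refl
  E-nat constr-e x = Hθ x

square-along-homotopy : {X Y B : Set} (u v : X → Y) (θ : ∀ x → u x ≡ v x) {L R : B → Y}
  (pY : ∀ w → L w ≡ R w) {a b : X} (pX : a ≡ b) {w w' : B} (q : w ≡ w')
  (Elu : u a ≡ L w) (Eru : u b ≡ R w) (Elv : v a ≡ L w') (Erv : v b ≡ R w') →
  trans (θ a) Elv ≡ trans Elu (cong L q) → trans (θ b) Erv ≡ trans Eru (cong R q) →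
  trans (cong v pX) Erv ≡ trans Elv (pY w') → trans (cong u pX) Eru ≡ trans Elu (pY w)
square-along-homotopy u v θ pY {a} refl {w} refl = along (θ a) (pY w)
  where
    along : {y₀ y₁ Lw Rw : _} (t : y₀ ≡ y₁) (P : Lw ≡ Rw)
      (Elu : y₀ ≡ Lw) (Eru : y₀ ≡ Rw) (Elv : y₁ ≡ Lw) (Erv : y₁ ≡ Rw) →
      trans t Elv ≡ trans Elu refl → trans t Erv ≡ trans Eru refl → trans refl Erv ≡ trans Elv P →
      trans refl Eru ≡ trans Elu P
    along refl P Elu Eru Elv Erv HL HR Kv =
      trans (sym (trans-reflʳ Eru)) (trans (sym HR) (trans Kv
        (cong (λ z → trans z P) (trans HL (trans-reflʳ Elu)))))

cancel-square-by-embedding : {X Y Z B : Set} {F : X → Y} → CongInjective F →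
  {L R : B → Y} (pZ : ∀ w → L w ≡ R w) {a b : Z} {g : Z → X} (pY : a ≡ b) {a' b' : X}
  (Ell : g a ≡ a') (Erl : g b ≡ b') (pX : a' ≡ b') {w w' : B}
  (Elf : F a' ≡ L w) (Erf : F b' ≡ R w) (Pf : trans (cong F pX) Erf ≡ trans Elf (pZ w))
  (q : w ≡ w') (El∘ : F (g a) ≡ L w') (Er∘ : F (g b) ≡ R w')
  (HEl : El∘ ≡ trans (cong F Ell) (trans Elf (cong L q)))
  (HEr : Er∘ ≡ trans (cong F Erl) (trans Erf (cong R q))) →
  trans (cong (F ∘ g) pY) Er∘ ≡ trans El∘ (pZ w') →
  trans (cong g pY) Erl ≡ trans Ell pX
cancel-square-by-embedding {F = F} inj pZ {g = g} pY Ell Erl pX {w} Elf Erf Pf refl _ _ refl refl =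
  cancel (pZ w) pY Ell Erl pX Elf Erf Pf
  where
    cancel : {Lw Rw : _} (P : Lw ≡ Rw) {a b : _} (pY : a ≡ b) {a' b' : _}
      (Ell : g a ≡ a') (Erl : g b ≡ b') (pX : a' ≡ b') (Elf : F a' ≡ Lw) (Erf : F b' ≡ Rw) →
      trans (cong F pX) Erf ≡ trans Elf P →
      trans (cong (F ∘ g) pY) (trans (cong F Erl) (trans Erf refl))
        ≡ trans (trans (cong F Ell) (trans Elf refl)) P →
      trans (cong g pY) Erl ≡ trans Ell pX
    cancel refl refl refl Erl refl refl .refl refl Pc = inj (trans (sym (trans-reflʳ _)) Pc)

unwhisker-square : {Y Z By Bz : Set} {h : Y → Z} → CongInjective h →
  (cY : By → Y) (cZ : Bz → Z) (hA : By → Bz) (hc : ∀ y → h (cY y) ≡ cZ (hA y))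
  {a a' : Y} {u v : By} (θc : a ≡ a') (gc : a' ≡ cY v) (fc : a ≡ cY u) (ψ : u ≡ v)
  {n k : Bz} (s₁ : hA v ≡ n) (s₂ : hA u ≡ k) (t : k ≡ n) →
  trans s₂ t ≡ trans (cong hA ψ) s₁ →
  trans (cong h θc) (trans (cong h gc) (trans (hc v) (cong cZ s₁)))
    ≡ trans (trans (cong h fc) (trans (hc u) (cong cZ s₂))) (cong cZ t) →
  trans θc gc ≡ trans fc (cong cY ψ)
unwhisker-square inj cY cZ hA hc refl gc fc refl refl refl .refl refl E =
  trans (inj (trans-injectiveˡ _ (trans E (trans-reflʳ _)))) (sym (trans-reflʳ fc))

flip-square : {Y B : Set} (cY : B → Y) {a b : Y} {m n : B} (t : a ≡ b) (vc : b ≡ cY n)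
  (uc : a ≡ cY m) (φ : m ≡ n) → trans t vc ≡ trans uc (cong cY φ) →
  trans (sym t) uc ≡ trans vc (cong cY (sym φ))
flip-square cY refl vc uc refl H = trans (sym (trans-reflʳ uc)) (trans (sym H) (sym (trans-reflʳ vc)))

module _ {S : Signature} where
  open Signature S
  open Alg

  PathLaw : (X Y : Alg S) (u : carrier X → carrier Y) → (∀ x → u (c X x) ≡ c Y (fmap A u x)) → Set
  PathLaw X Y u uc = (j : J) (x : ⟦ Q j ⟧ (carrier X)) →
    trans (cong u (p X j x)) (⟦ r j ⟧₁ u uc x) ≡ trans (⟦ l j ⟧₁ u uc x) (p Y j (fmap (Q j) u x))

  PathLaw-along : {X Y : Alg S} {u v : carrier X → carrier Y}
    {uc : ∀ x → u (c X x) ≡ c Y (fmap A u x)} {vc : ∀ x → v (c X x) ≡ c Y (fmap A v x)}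
    (θ : ∀ x → u x ≡ v x) →
    (∀ x → trans (θ (c X x)) (vc x) ≡ trans (uc x) (cong (c Y) (fmap₂ A θ x))) →
    PathLaw X Y v vc → PathLaw X Y u uc
  PathLaw-along {X} {Y} {u} {v} {uc} {vc} θ Hθ law j x =
    square-along-homotopy u v θ (p Y j) (p X j x) (fmap₂ (Q j) θ x) _ _ _ _
      (E-nat (l j) x) (E-nat (r j) x) (law j x)
    where open EndpointNat {A = A} {cX = c X} {cY = c Y} u v uc vc θ Hθ

  PathLaw-reflect : {X Y Z : Alg S} (f : Y ⟶ Z) → CongInjective (fun f) →
    {g : carrier X → carrier Y} (gc : ∀ x → g (c X x) ≡ c Y (fmap A g x)) →
    PathLaw X Z (fun f ∘ g) (EndpointComp.compc {A = A} {cZ = c Z} g gc (fun f) (fun-c f)) →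
    PathLaw X Y g gc
  PathLaw-reflect {X} {Y} {Z} f inj {g} gc law j x =
    cancel-square-by-embedding inj (p Z j) (p X j x)
      (⟦ l j ⟧₁ g gc x) (⟦ r j ⟧₁ g gc x) (p Y j (fmap (Q j) g x))
      (⟦ l j ⟧₁ (fun f) (fun-c f) (fmap (Q j) g x)) (⟦ r j ⟧₁ (fun f) (fun-c f) (fmap (Q j) g x))
      (fun-p f j (fmap (Q j) g x)) (fmap-∘ (Q j) g (fun f) x)
      _ _ (E-comp (l j) x) (E-comp (r j) x) (law j x)
    where open EndpointComp {A = A} {cX = c X} {cY = c Y} {cZ = c Z} g gc (fun f) (fun-c f)

  module _ {X Y : Alg S} where

    ⇒-sym : {f g : X ⟶ Y} → f ⇒ g → g ⇒ f
    ⇒-sym {f} {g} θ = record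
      { hom = λ x → sym (hom θ x)
      ; hom-c = λ x → trans (flip-square (c Y) (hom θ (c X x)) (fun-c g x) (fun-c f x)
                               (fmap₂ A (hom θ) x) (hom-c θ x))
                             (cong (λ z → trans (fun-c g x) (cong (c Y) z)) (sym (fmap₂-sym A (hom θ) x)))
      }

    ⇒-invertible : {f g : X ⟶ Y} (θ : f ⇒ g) → IsInvertible₂ θ
    ⇒-invertible θ = record
      { inv₂ = ⇒-sym θ
      ; inv₂-left = λ x → trans-symʳ (hom θ x)
      ; inv₂-right = λ x → trans-symˡ (hom θ x)
      }

    ⇒-with-hom : {f g : X ⟶ Y} (θ : f ⇒ g) (θ' : ∀ x → fun f x ≡ fun g x) →
      (∀ x → θ' x ≡ hom θ x) → f ⇒ g
    ⇒-with-hom {f} {g} θ θ' H = record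
      { hom = θ'
      ; hom-c = λ x → trans (cong (λ z → trans z (fun-c g x)) (H (c X x)))
                   (trans (hom-c θ x)
                     (cong (λ z → trans (fun-c f x) (cong (c Y) z)) (sym (fmap₂-cong A θ' (hom θ) H x))))
      }

  ⇒-reflect▹ : {X Y Z : Alg S} {g₁ g₂ : X ⟶ Y} (f : Y ⟶ Z) → CongInjective (fun f) →
    (θ : ∀ x → fun g₁ x ≡ fun g₂ x) (Θ : g₁ · f ⇒ g₂ · f) →
    (∀ x → cong (fun f) (θ x) ≡ hom Θ x) → g₁ ⇒ g₂
  ⇒-reflect▹ {X} {Y} {Z} {g₁} {g₂} f inj θ Θ H = record
    { hom = θ
    ; hom-c = λ x → unwhisker-square inj (c Y) (c Z) (fmap A (fun f)) (fun-c f)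
        (θ (c X x)) (fun-c g₂ x) (fun-c g₁ x) (fmap₂ A θ x)
        (fmap-∘ A (fun g₂) (fun f) x) (fmap-∘ A (fun g₁) (fun f) x)
        (fmap₂ A (λ y → cong (fun f) (θ y)) x) (eq (fmap₂-whR A θ (fun f) x))
        (hom-c (⇒-with-hom Θ (λ y → cong (fun f) (θ y)) H) x)
    }

module AdjointEquivalence {S : Signature} {X Y : Alg S} (f : X ⟶ Y) (E : IsAdjEquivType (fun f)) where
  open Signature S using (A)
  open Alg
  open IsAdjEquivType E
  open IsAdjEquivTypeProperties E

  F : carrier X → carrier Y
  F = fun f

  -- Chosen so that ε becomes a 2-cell: cong F (gc y) solves the counit square.
  gc : (y : ⟦ A ⟧ (carrier Y)) → inv (c Y y) ≡ c X (fmap A inv y)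
  gc y = cong⁻¹ (trans (trans (ε (c Y y)) (fun-c (id₁ Y) y))
                       (sym (trans (trans (fun-c f (fmap A inv y)) (cong (c Y) (fmap-∘ A inv F y)))
                                   (cong (c Y) (fmap₂ A ε y)))))

  open EndpointComp {A = A} {cX = c Y} {cY = c X} {cZ = c Y} inv gc F (fun-c f) using (compc)

  counit-square : (y : ⟦ A ⟧ (carrier Y)) →
    trans (ε (c Y y)) (fun-c (id₁ Y) y) ≡ trans (compc y) (cong (c Y) (fmap₂ A ε y))
  counit-square y = sym (begin
      trans (trans (cong F (gc y)) R) Eε
        ≡⟨ cong (λ z → trans (trans z R) Eε) (cong-cong⁻¹ _) ⟩
      trans (trans (trans L (sym (trans R Eε))) R) Eε
        ≡⟨ trans-sym-trans-cancel L R Eε ⟩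
      L ∎)
    where
      open ≡-Reasoning
      L : F (inv (c Y y)) ≡ c Y (fmap A id y)
      L = trans (ε (c Y y)) (fun-c (id₁ Y) y)
      R : F (c X (fmap A inv y)) ≡ c Y (fmap A (F ∘ inv) y)
      R = trans (fun-c f (fmap A inv y)) (cong (c Y) (fmap-∘ A inv F y))
      Eε : c Y (fmap A (F ∘ inv) y) ≡ c Y (fmap A id y)
      Eε = cong (c Y) (fmap₂ A ε y)

  radj : Y ⟶ X
  radj = record
    { fun = inv
    ; fun-c = gc
    ; fun-p = PathLaw-reflect {X = Y} f cong-injective gc
                (PathLaw-along {X = Y} {Y = Y} ε counit-square (fun-p (id₁ Y)))
    }

  counit : radj · f ⇒ id₁ Y
  counit = record { hom = ε ; hom-c = counit-square }

  unit : id₁ X ⇒ f · radj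
  unit = ⇒-reflect▹ f cong-injective η
    (lunitor f ∙₂ rinvunitor f ∙₂ (f ◃ ⇒-sym counit) ∙₂ lassociator f radj f)
    (λ x → trans (cong-η x) (sym (trans-reflʳ _)))

  isAdjEquivAlg : IsAdjEquivAlg f
  isAdjEquivAlg = record
    { radj = radj
    ; unit = unit
    ; counit = counit
    ; unit-inv = ⇒-invertible unit
    ; counit-inv = ⇒-invertible counit
    ; triangle₁ = λ x → trans (trans-reflʳ _)
        (trans (cong (λ z → trans z (ε (F x))) (trans-reflʳ _)) (tri₁ x))
    ; triangle₂ = λ y → trans (trans-reflʳ _)
        (trans (cong (λ z → trans z (cong inv (ε y))) (trans-reflʳ _)) (tri₂ y))
    }

proposition10p8 : (S : Signature) (X Y : Alg S) (f : X ⟶ Y) →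
    IsAdjEquivType (fun f) → IsAdjEquivAlg f
proposition10p8 S X Y f E = AdjointEquivalence.isAdjEquivAlg f E
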